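{- Let $\mu\vdash n$ and let $a=(a_1,\dots,a_h)\vDash n$ be a composition with $\mu\unrhd\lambda(a)$. Define $\rho^i$ and $a^i$ inductively by $\rho^0=\mu$, $a^0=a$, and for $1\le i\le h$, $$\rho^i=\rho(\rho^{i-1},a^{i-1})\vdash \sum_{j=1}^{h-i}a_j,\qquad a^i=(a^{i-1})'\vDash\sum_{j=1}^{h-i}a_j$$ (so $\rho^h$ is the empty partition). Define a tableau $T$ of shape $\mu$ and weight $a$ by $T(p,q)=h-i$ if $(p,q)\in D_{\rho^i}\setminus D_{\rho^{i+1}}$, $0\le i\le h-1$. Then $T$ is the greatest element of the partially ordered set $(\mathrm{STab}(\mu,a),\le)$.
   Context: A composition of $n$ is a sequence $a=(a_1,\dots,a_h)$ of positive integers with $\sum a_i=n$ (written $a\vDash n$); $h=h(a)$ is its height. A partition of $n$ ($\mu\vdash n$) is a non-increasing composition $\mu=(\mu_1,\dots,\mu_k)$; by convention $\mu_i=0$ for $i>k$, and sequences with trailing zero parts are identified with the partition obtained by deleting the zeros. For compositions $a=(a_1,\dots,a_h)$, $b=(b_1,\dots,b_k)$ of $n$, $a\unrhd b$ means $k\ge h$ and $\sum_{i=1}^j a_i\ge\sum_{i=1}^j b_i$ for $j=1,\dots,h$; $a\rhd b$ means $a\unrhd b$ and $a\ne b$. $\lambda(a)$ is the partition obtained by rearranging the parts of $a$ in non-increasing order. $a'=(a_1,\dots,a_{h-1})$. $D_\mu=\{(i,j)\in\mathbb Z^2: 1\le i\le k,\,1\le j\le\mu_i\}$. $\mathrm{STab}(\mu,a)$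 is the set of maps $T:D_\mu\to\{1,\dots,h\}$ with $T(i,j)\le T(i,j+1)$, $T(i,j)<T(i+1,j)$ (whenever both boxes lie in $D_\mu$), and $|T^{ -1}(\{i\})|=a_i$ for all $i$. For a partition $\mu=(\mu_1,\dots,\mu_k)\vdash n$ and $a\vDash n$ with $\mu\unrhd\lambda(a)$, let $s=s(\mu,a)=\max\{i:1\le i\le k,\ \mu_i\ge a_h\}$ and define $\rho(\mu,a)=(\rho_1,\dots,\rho_{k-1})\vdash n-a_h$ by $\rho_i=\mu_i$ for $i<s$, $\rho_s=\mu_s-(a_h-\mu_{s+1})$, $\rho_i=\mu_{i+1}$ for $s<i\le k-1$. Partial order on $\mathrm{STab}(\mu,a)$: for $T,S\in\mathrm{STab}(\mu,a)$ and $1\le p\le h$ put $\tau^{(p)}=(|\{j: T(i,j)\le p\}|)_{i=1}^k$ and $\sigma^{(p)}=(|\{j:S(i,j)\le p\}|)_{i=1}^k$; then $S\le T$ iff $S=T$ or there is $p$ with $\tau^{(p')}=\sigma^{(p')}$ for all $p<p'\le h$ and $\tau^{(p)}\rhd\sigma^{(p)}$. -}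

module Defs where

open import Data.Nat using (ℕ; zero; suc; _+_; _∸_; _≤_; _<_; _≤ᵇ_; _<ᵇ_; _≡ᵇ_; _⊔_)
open import Data.Bool using (Bool; true; false; if_then_else_; T)
open import Data.Nat.ListAction using (sum)
open import Data.List using (List; []; _∷_; length; take; map; foldr; filter; reverse; upTo; applyUpTo)
open import Data.List.Relation.Unary.All using (All)
open import Data.Product using (Σ; ∃; _×_; _,_)
open import Data.Sum using (_⊎_)
open import Relation.Binary.PropositionalEquality using (_≡_)
open import Relation.Nullary using (¬_)

-- Basic list helpers (all indices 0-based; missing entries read as 0,
-- matching the convention μ_i = 0 for i > k)

nth : List ℕ → ℕ → ℕ
nth []       _       = 0
nth (x ∷ xs) zero    = x
nth (x ∷ xs) (suc i) = nth xs i

lastOr0 : List ℕ → ℕ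
lastOr0 []           = 0
lastOr0 (x ∷ [])     = x
lastOr0 (x ∷ y ∷ xs) = lastOr0 (y ∷ xs)

dropLast : List ℕ → List ℕ
dropLast []           = []
dropLast (x ∷ [])     = []
dropLast (x ∷ y ∷ xs) = x ∷ dropLast (y ∷ xs)

dropZerosFront : List ℕ → List ℕ
dropZerosFront []          = []
dropZerosFront (zero ∷ xs) = dropZerosFront xs
dropZerosFront (suc x ∷ xs) = suc x ∷ xs

stripZeros : List ℕ → List ℕ
stripZeros xs = reverse (dropZerosFront (reverse xs))

data NonIncreasing : List ℕ → Set where
  ni-[]  : NonIncreasing []
  ni-[_] : ∀ x → NonIncreasing (x ∷ [])
  ni-∷   : ∀ {x y xs} → y ≤ x → NonIncreasing (y ∷ xs) → NonIncreasing (x ∷ y ∷ xs)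

Positive : List ℕ → Set
Positive xs = All (λ x → 1 ≤ x) xs

IsComposition : List ℕ → ℕ → Set
IsComposition a n = Positive a × sum a ≡ n

IsPartition : List ℕ → ℕ → Set
IsPartition μ n = IsComposition μ n × NonIncreasing μ

_⊵_ : List ℕ → List ℕ → Set
a ⊵ b = (length a ≤ length b) ×
        (∀ j → 1 ≤ j → j ≤ length a → sum (take j b) ≤ sum (take j a))

_▷_ : List ℕ → List ℕ → Set
a ▷ b = a ⊵ b × ¬ (a ≡ b)

insertDesc : ℕ → List ℕ → List ℕ
insertDesc x []       = x ∷ []
insertDesc x (y ∷ ys) = if y ≤ᵇ x then x ∷ y ∷ ys else y ∷ insertDesc x ys

lam : List ℕ → List ℕ
lam = foldr insertDesc []

-- ρ(μ,a)   (1-based index i of the paper = 0-based i-1 here)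

-- s(μ,a) = max { i : 1 ≤ i ≤ k, μ_i ≥ a_h }   (0 if the set is empty)
sIdx : List ℕ → List ℕ → ℕ
sIdx μ a = foldr _⊔_ 0
  (applyUpTo (λ i → if lastOr0 a ≤ᵇ nth μ i then suc i else 0) (length μ))

-- the i-th part (1-based i) of ρ(μ,a), with μ_{k+1} = 0
rhoPart : List ℕ → List ℕ → ℕ → ℕ
rhoPart μ a i =
  if i <ᵇ sIdx μ a then nth μ (i ∸ 1)
  else if i ≡ᵇ sIdx μ a then nth μ (i ∸ 1) ∸ (lastOr0 a ∸ nth μ i)
  else nth μ i

rho : List ℕ → List ℕ → List ℕ
rho μ a = stripZeros (applyUpTo (λ i → rhoPart μ a (suc i)) (length μ))

aSeq : List ℕ → ℕ → List ℕ
aSeq a zero    = a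
aSeq a (suc i) = dropLast (aSeq a i)

rhoSeq : List ℕ → List ℕ → ℕ → List ℕ
rhoSeq μ a zero    = μ
rhoSeq μ a (suc i) = rho (rhoSeq μ a i) (aSeq a i)

-- Young diagrams and tableaux.
-- A tableau is a function  T p q  (p = row, q = column, both 0-based);
-- only its values on D_μ matter.

Tableau : Set
Tableau = ℕ → ℕ → ℕ

InD : List ℕ → ℕ → ℕ → Set
InD μ p q = q < nth μ p

inDᵇ : List ℕ → ℕ → ℕ → Bool
inDᵇ μ p q = q <ᵇ nth μ p

rowCount : List ℕ → (ℕ → Bool) → Tableau → ℕ → ℕ
rowCount μ P t p = length (filter (λ q → T? (P (t p q))) (upTo (nth μ p)))
  where
  open import Relation.Nullary.Decidable using (Dec; yes; no)
  open import Data.Bool.Properties using (T?)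

weightOf : List ℕ → Tableau → ℕ → ℕ
weightOf μ t v = sum (applyUpTo (rowCount μ (λ x → x ≡ᵇ v) t) (length μ))

IsSSYT : List ℕ → List ℕ → Tableau → Set
IsSSYT μ a t =
  (∀ p q → InD μ p q → 1 ≤ t p q × t p q ≤ length a) ×
  (∀ p q → InD μ p (suc q) → t p q ≤ t p (suc q)) ×
  (∀ p q → InD μ (suc p) q → t p q < t (suc p) q) ×
  (∀ i → 1 ≤ i → i ≤ length a → weightOf μ t i ≡ nth a (i ∸ 1))

tau : List ℕ → Tableau → ℕ → List ℕ
tau μ t v = applyUpTo (rowCount μ (λ x → x ≤ᵇ v) t) (length μ)

-- the partial order S ≤ T on STab(μ,a); the sequences τ^{(p)} are
-- compared as partitions (trailing zeros deleted) for ▷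
_≤Tab[_,_]_ : Tableau → List ℕ → List ℕ → Tableau → Set
S ≤Tab[ μ , a ] T =
  (∀ p q → InD μ p q → S p q ≡ T p q) ⊎
  (Σ ℕ λ p → 1 ≤ p × p ≤ length a ×
     (∀ p' → p < p' → p' ≤ length a → tau μ T p' ≡ tau μ S p') ×
     (stripZeros (tau μ T p) ▷ stripZeros (tau μ S p)))

-- The tableau of the theorem:
-- T(p,q) = h - i  if (p,q) ∈ D_{ρ^i} \ D_{ρ^{i+1}},  0 ≤ i ≤ h-1
-- (the first such i is taken; 0 if there is none, i.e. outside D_μ)

levelFrom : List ℕ → List ℕ → ℕ → ℕ → ℕ → ℕ → ℕ
levelFrom μ a p q i zero    = 0
levelFrom μ a p q i (suc r) =
  if inDᵇ (rhoSeq μ a i) p q ∧ not (inDᵇ (rhoSeq μ a (suc i)) p q)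
  then length a ∸ i
  else levelFrom μ a p q (suc i) r
  where open import Data.Bool using (_∧_; not)

greedyTab : List ℕ → List ℕ → Tableau
greedyTab μ a p q = levelFrom μ a p q 0 (length a)

-- Let c = a_h.  Passing from μ to ρ(μ,a) deletes c boxes: the last row s with μ_s ≥ c keeps
-- μ_s + μ_{s+1} − c boxes and every row below it moves up by one.  Hence ρ(μ,a) interlaces μ
-- (μ_{p+1} ≤ ρ_p ≤ μ_p), and among all sequences interlacing μ with total |μ| − c it is the most
-- dominant one.  It still dominates λ(a'), so the recursion never gets stuck: each ρ^i interlaces
-- ρ^{i-1}, T is semistandard, and the entries ≤ u of T fill exactly the diagram of ρ^{h−u}, that is
-- τ^{(u)}(T) = ρ^{h−u}.  For another S ∈ STab(μ,a), let p be the largest level with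
-- τ^{(p)}(S) ≠ τ^{(p)}(T).  Then τ^{(p+1)}(S) = ρ^{h−p−1}, and the columns of S being strict makes
-- τ^{(p)}(S) interlace it with total |ρ^{h−p−1}| − a_{p+1}; by maximality τ^{(p)}(S) ⊴ ρ^{h−p}.

module Submission where

open import Defs
open import Data.Bool using (Bool; true; false; T; if_then_else_)
open import Data.Bool.Properties using (T?)
open import Data.Empty using (⊥-elim)
open import Data.List using (List; []; _∷_; _++_; length; take; filter; reverse; upTo; applyUpTo; foldr)
open import Data.List.Relation.Unary.All as All using (All; []; _∷_)
open import Data.List.Relation.Unary.AllPairs using (AllPairs; []; _∷_)
open import Data.List.Properties using (≡-dec; length-++; filter-++; upTo-∷ʳ; reverse-involutive; reverse-++; length-applyUpTo)
open import Data.Nat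
open import Data.Nat.ListAction using (sum)
open import Data.Nat.Properties
open import Algebra.Properties.CommutativeSemigroup +-commutativeSemigroup using (interchange; x∙yz≈y∙xz; xy∙z≈xz∙y)
open import Data.Product using (Σ; ∃-syntax; _×_; _,_; proj₁; proj₂)
open import Data.Sum using (_⊎_; inj₁; inj₂)
open import Function using (_∘_)
open import Relation.Binary.PropositionalEquality
open import Relation.Binary.Definitions using (tri<; tri≈; tri>)
open import Relation.Nullary using (¬_; yes; no; Dec)

sumBelow : (ℕ → ℕ) → ℕ → ℕ
sumBelow f zero    = 0
sumBelow f (suc j) = sumBelow f j + f j

sumBelow-suc : ∀ f j → sumBelow f (suc j) ≡ f 0 + sumBelow (f ∘ suc) j
sumBelow-suc f zero    = +-comm 0 (f 0)
sumBelow-suc f (suc j) = begin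
  sumBelow f (suc j) + f (suc j)           ≡⟨ cong (_+ f (suc j)) (sumBelow-suc f j) ⟩
  f 0 + sumBelow (f ∘ suc) j + f (suc j)   ≡⟨ +-assoc (f 0) _ _ ⟩
  f 0 + sumBelow (f ∘ suc) (suc j)         ∎
  where open ≡-Reasoning

sumBelow-cong : ∀ f g j → (∀ i → i < j → f i ≡ g i) → sumBelow f j ≡ sumBelow g j
sumBelow-cong f g zero    f≡g = refl
sumBelow-cong f g (suc j) f≡g =
  cong₂ _+_ (sumBelow-cong f g j (λ i i<j → f≡g i (m<n⇒m<1+n i<j))) (f≡g j ≤-refl)

sumBelow-mono : ∀ f g j → (∀ i → i < j → f i ≤ g i) → sumBelow f j ≤ sumBelow g j
sumBelow-mono f g zero    f≤g = z≤n
sumBelow-mono f g (suc j) f≤g =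
  +-mono-≤ (sumBelow-mono f g j (λ i i<j → f≤g i (m<n⇒m<1+n i<j))) (f≤g j ≤-refl)

sumBelow-+ : ∀ f g j → sumBelow (λ i → f i + g i) j ≡ sumBelow f j + sumBelow g j
sumBelow-+ f g zero    = refl
sumBelow-+ f g (suc j) =
  trans (cong (_+ (f j + g j)) (sumBelow-+ f g j)) (interchange (sumBelow f j) _ _ _)

sumBelow-+-split : ∀ f j d → sumBelow f (j + d) ≡ sumBelow f j + sumBelow (λ i → f (j + i)) d
sumBelow-+-split f j zero    = trans (cong (sumBelow f) (+-identityʳ j)) (sym (+-identityʳ _))
sumBelow-+-split f j (suc d) = begin
  sumBelow f (j + suc d)                                ≡⟨ cong (sumBelow f) (+-suc j d) ⟩
  sumBelow f (j + d) + f (j + d)                        ≡⟨ cong (_+ f (j + d)) (sumBelow-+-split f j d) ⟩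
  sumBelow f j + sumBelow (λ i → f (j + i)) d + f (j + d) ≡⟨ +-assoc (sumBelow f j) _ _ ⟩
  sumBelow f j + sumBelow (λ i → f (j + i)) (suc d)     ∎
  where open ≡-Reasoning

sumBelow-monoʳ : ∀ f {j j'} → j ≤ j' → sumBelow f j ≤ sumBelow f j'
sumBelow-monoʳ f {j} {j'} j≤j' = begin
  sumBelow f j                                          ≤⟨ m≤m+n _ _ ⟩
  sumBelow f j + sumBelow (λ i → f (j + i)) (j' ∸ j)    ≡⟨ sym (sumBelow-+-split f j (j' ∸ j)) ⟩
  sumBelow f (j + (j' ∸ j))                             ≡⟨ cong (sumBelow f) (m+[n∸m]≡n j≤j') ⟩
  sumBelow f j'                                         ∎
  where open ≤-Reasoning

≤-sumBelow : ∀ f {p K} → p < K → f p ≤ sumBelow f K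
≤-sumBelow f {p} p<K = ≤-trans (m≤n+m (f p) (sumBelow f p)) (sumBelow-monoʳ f p<K)

sumBelow-zero : ∀ j → sumBelow (λ _ → 0) j ≡ 0
sumBelow-zero zero    = refl
sumBelow-zero (suc j) = trans (+-identityʳ _) (sumBelow-zero j)

VanishesFrom : (ℕ → ℕ) → ℕ → Set
VanishesFrom f K = ∀ i → K ≤ i → f i ≡ 0

sumBelow-vanishing : ∀ f {K j} → VanishesFrom f K → K ≤ j → sumBelow f j ≡ sumBelow f K
sumBelow-vanishing f {K} {j} f≡0 K≤j = begin
  sumBelow f j                                          ≡⟨ cong (sumBelow f) (sym (m+[n∸m]≡n K≤j)) ⟩
  sumBelow f (K + (j ∸ K))                              ≡⟨ sumBelow-+-split f K (j ∸ K) ⟩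
  sumBelow f K + sumBelow (λ i → f (K + i)) (j ∸ K)     ≡⟨ cong (sumBelow f K +_) tail≡0 ⟩
  sumBelow f K + 0                                      ≡⟨ +-identityʳ _ ⟩
  sumBelow f K                                          ∎
  where
  open ≡-Reasoning
  tail≡0 : sumBelow (λ i → f (K + i)) (j ∸ K) ≡ 0
  tail≡0 = trans (sumBelow-cong _ _ (j ∸ K) (λ i _ → f≡0 (K + i) (m≤m+n K i))) (sumBelow-zero (j ∸ K))

Antitone : (ℕ → ℕ) → Set
Antitone f = ∀ i → f (suc i) ≤ f i

antitone-vanishesFrom : ∀ f {i} → Antitone f → f i ≡ 0 → VanishesFrom f i
antitone-vanishesFrom f {i} anti fi≡0 j i≤j = n≤0⇒n≡0 (go (j ∸ i) j (m+[n∸m]≡n i≤j))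
  where
  go : ∀ d j → i + d ≡ j → f j ≤ 0
  go zero    j refl = ≤-reflexive (trans (cong f (+-identityʳ i)) fi≡0)
  go (suc d) j refl = ≤-trans (subst (λ x → f x ≤ f (i + d)) (sym (+-suc i d)) (anti (i + d))) (go d (i + d) refl)

antitone-nth : ∀ {xs} → NonIncreasing xs → Antitone (nth xs)
antitone-nth ni-[]              _       = z≤n
antitone-nth ni-[ x ]           zero    = z≤n
antitone-nth ni-[ x ]           (suc i) = z≤n
antitone-nth (ni-∷ y≤x y∷xs-ni) zero    = y≤x
antitone-nth (ni-∷ y≤x y∷xs-ni) (suc i) = antitone-nth y∷xs-ni i

sumBelow-interlacing : ∀ f ν {K c} → VanishesFrom f K → VanishesFrom ν K → (∀ p → f (suc p) ≤ ν p) →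
                       sumBelow ν K + c ≡ sumBelow f K → ∀ j → sumBelow ν j + c ≤ sumBelow f (suc j)
sumBelow-interlacing f ν {K} {c} f≡0 ν≡0 f≤ν total j = +-cancelʳ-≤ νTail _ _ (begin
  sumBelow ν j + c + νTail           ≡⟨ xy∙z≈xz∙y (sumBelow ν j) c νTail ⟩
  sumBelow ν j + νTail + c           ≡⟨ cong (_+ c) ν-split ⟩
  sumBelow ν K + c                   ≡⟨ total ⟩
  sumBelow f K                       ≡⟨ sym f-split ⟩
  sumBelow f (suc j) + fTail         ≤⟨ +-monoʳ-≤ (sumBelow f (suc j)) (sumBelow-mono _ _ K (λ i _ → f≤ν (j + i))) ⟩
  sumBelow f (suc j) + νTail         ∎)
  where
  open ≤-Reasoning
  νTail = sumBelow (λ i → ν (j + i)) K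
  fTail = sumBelow (λ i → f (suc j + i)) K
  ν-split : sumBelow ν j + νTail ≡ sumBelow ν K
  ν-split = trans (sym (sumBelow-+-split ν j K)) (sumBelow-vanishing ν ν≡0 (m≤n+m K j))
  f-split : sumBelow f (suc j) + fTail ≡ sumBelow f K
  f-split = trans (sym (sumBelow-+-split f (suc j) K)) (sumBelow-vanishing f f≡0 (m≤n+m K (suc j)))

dominated-support : ∀ ν ρ {K} → Antitone ν → VanishesFrom ν K → VanishesFrom ρ K →
                    (∀ j → sumBelow ν j ≤ sumBelow ρ j) → sumBelow ρ K ≡ sumBelow ν K →
                    ∀ i → ν i ≡ 0 → ρ i ≡ 0
dominated-support ν ρ {K} ν-antitone ν≡0 ρ≡0 ν≼ρ totals i νᵢ≡0 =
  n≤0⇒n≡0 (+-cancelˡ-≤ (sumBelow ρ K) _ _ (begin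
    sumBelow ρ K + ρ i            ≡⟨ cong (_+ ρ i) (trans totals (sym ν-total)) ⟩
    sumBelow ν i + ρ i            ≤⟨ +-monoˡ-≤ (ρ i) (ν≼ρ i) ⟩
    sumBelow ρ (suc i)            ≤⟨ sumBelow-monoʳ ρ (m≤n+m (suc i) K) ⟩
    sumBelow ρ (K + suc i)        ≡⟨ sumBelow-vanishing ρ ρ≡0 (m≤m+n K (suc i)) ⟩
    sumBelow ρ K                  ≡⟨ sym (+-identityʳ _) ⟩
    sumBelow ρ K + 0              ∎))
  where
  open ≤-Reasoning
  ν-total : sumBelow ν i ≡ sumBelow ν K
  ν-total = trans (sym (sumBelow-vanishing ν (antitone-vanishesFrom ν ν-antitone νᵢ≡0) (m≤m+n i K)))
                  (sumBelow-vanishing ν ν≡0 (m≤n+m K i))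

nth-beyond : ∀ xs {i} → length xs ≤ i → nth xs i ≡ 0
nth-beyond []       _         = refl
nth-beyond (x ∷ xs) (s≤s len≤i) = nth-beyond xs len≤i

nth-vanishesFrom : ∀ xs → VanishesFrom (nth xs) (length xs)
nth-vanishesFrom xs i = nth-beyond xs

nth-applyUpTo : ∀ g {K i} → i < K → nth (applyUpTo g K) i ≡ g i
nth-applyUpTo g {suc K} {zero}  _         = refl
nth-applyUpTo g {suc K} {suc i} (s≤s i<K) = nth-applyUpTo (g ∘ suc) i<K

nth-applyUpTo-beyond : ∀ g {K i} → K ≤ i → nth (applyUpTo g K) i ≡ 0
nth-applyUpTo-beyond g {K} K≤i = nth-beyond (applyUpTo g K) (subst (_≤ _) (sym (length-applyUpTo g K)) K≤i)

nth-injective : ∀ xs ys → length xs ≡ length ys → (∀ i → nth xs i ≡ nth ys i) → xs ≡ ys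
nth-injective []       []       _   _     = refl
nth-injective (x ∷ xs) (y ∷ ys) len nth≡ =
  cong₂ _∷_ (nth≡ 0) (nth-injective xs ys (suc-injective len) (nth≡ ∘ suc))

sum-take : ∀ xs j → sum (take j xs) ≡ sumBelow (nth xs) j
sum-take []       zero    = refl
sum-take []       (suc j) = sym (sumBelow-zero (suc j))
sum-take (x ∷ xs) zero    = refl
sum-take (x ∷ xs) (suc j) = trans (cong (x +_) (sum-take xs j)) (sym (sumBelow-suc (nth (x ∷ xs)) j))

sum-nth : ∀ xs → sum xs ≡ sumBelow (nth xs) (length xs)
sum-nth []       = refl
sum-nth (x ∷ xs) = trans (cong (x +_) (sum-nth xs)) (sym (sumBelow-suc (nth (x ∷ xs)) (length xs)))

sum-applyUpTo : ∀ g K → sum (applyUpTo g K) ≡ sumBelow g K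
sum-applyUpTo g zero    = refl
sum-applyUpTo g (suc K) = trans (cong (g 0 +_) (sum-applyUpTo (g ∘ suc) K)) (sym (sumBelow-suc g K))

nth-++-0 : ∀ xs i → nth (xs ++ 0 ∷ []) i ≡ nth xs i
nth-++-0 []       zero    = refl
nth-++-0 []       (suc i) = refl
nth-++-0 (x ∷ xs) zero    = refl
nth-++-0 (x ∷ xs) (suc i) = nth-++-0 xs i

nth-reverse-dropZerosFront : ∀ xs i → nth (reverse (dropZerosFront xs)) i ≡ nth (reverse xs) i
nth-reverse-dropZerosFront []           i = refl
nth-reverse-dropZerosFront (zero ∷ xs)  i = begin
  nth (reverse (dropZerosFront xs)) i  ≡⟨ nth-reverse-dropZerosFront xs i ⟩
  nth (reverse xs) i                   ≡⟨ sym (nth-++-0 (reverse xs) i) ⟩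
  nth (reverse xs ++ 0 ∷ []) i         ≡⟨ cong (λ l → nth l i) (sym (reverse-++ (0 ∷ []) xs)) ⟩
  nth (reverse (0 ∷ xs)) i             ∎
  where open ≡-Reasoning
nth-reverse-dropZerosFront (suc x ∷ xs) i = refl

nth-stripZeros : ∀ xs i → nth (stripZeros xs) i ≡ nth xs i
nth-stripZeros xs i =
  trans (nth-reverse-dropZerosFront (reverse xs) i) (cong (λ l → nth l i) (reverse-involutive xs))

dropZerosFront-view : ∀ xs → dropZerosFront xs ≡ [] ⊎ Σ ℕ λ k → Σ (List ℕ) λ ys → dropZerosFront xs ≡ suc k ∷ ys
dropZerosFront-view []           = inj₁ refl
dropZerosFront-view (zero ∷ xs)  = dropZerosFront-view xs
dropZerosFront-view (suc x ∷ xs) = inj₂ (x , xs , refl)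

nth-++-length : ∀ xs y → nth (xs ++ y ∷ []) (length xs) ≡ y
nth-++-length []       y = refl
nth-++-length (x ∷ xs) y = nth-++-length xs y

length-stripZeros-≤ : ∀ xs {L} → VanishesFrom (nth xs) L → length (stripZeros xs) ≤ L
length-stripZeros-≤ xs {L} xs≡0 with dropZerosFront-view (reverse xs)
... | inj₁ dzf≡[] = subst (λ l → length (reverse l) ≤ L) (sym dzf≡[]) z≤n
... | inj₂ (k , ys , dzf≡) = subst (_≤ L) (sym length-strip) (≮⇒≥ last-vanishes)
  where
  strip≡ : stripZeros xs ≡ reverse ys ++ suc k ∷ []
  strip≡ = trans (cong reverse dzf≡) (reverse-++ (suc k ∷ []) ys)
  length-strip : length (stripZeros xs) ≡ suc (length (reverse ys))
  length-strip = trans (cong length strip≡) (trans (length-++ (reverse ys)) (+-comm _ 1))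
  last-vanishes : ¬ (L < suc (length (reverse ys)))
  last-vanishes L<len = 0≢1+n (begin
    0                                                         ≡⟨ sym (xs≡0 _ (≤-pred L<len)) ⟩
    nth xs (length (reverse ys))                              ≡⟨ sym (nth-stripZeros xs _) ⟩
    nth (stripZeros xs) (length (reverse ys))                 ≡⟨ cong (λ l → nth l (length (reverse ys))) strip≡ ⟩
    nth (reverse ys ++ suc k ∷ []) (length (reverse ys))      ≡⟨ nth-++-length (reverse ys) (suc k) ⟩
    suc k                                                     ∎)
    where open ≡-Reasoning

stripZeros-injective : ∀ xs ys → length xs ≡ length ys → stripZeros xs ≡ stripZeros ys → xs ≡ ys
stripZeros-injective xs ys len strip≡ = nth-injective xs ys len
  (λ i → trans (sym (nth-stripZeros xs i)) (trans (cong (λ l → nth l i) strip≡) (nth-stripZeros ys i)))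

stripZeros-⊵ : ∀ xs ys → (∀ i → nth ys i ≡ 0 → nth xs i ≡ 0) →
               (∀ j → sumBelow (nth ys) j ≤ sumBelow (nth xs) j) → stripZeros xs ⊵ stripZeros ys
stripZeros-⊵ xs ys support ys≼xs = length≤ , prefix≤
  where
  length≤ : length (stripZeros xs) ≤ length (stripZeros ys)
  length≤ = length-stripZeros-≤ xs (λ i len≤i →
    support i (trans (sym (nth-stripZeros ys i)) (nth-beyond (stripZeros ys) len≤i)))
  sum-take-stripZeros : ∀ zs j → sum (take j (stripZeros zs)) ≡ sumBelow (nth zs) j
  sum-take-stripZeros zs j = trans (sum-take (stripZeros zs) j) (sumBelow-cong _ _ j (λ i _ → nth-stripZeros zs i))
  prefix≤ : ∀ j → 1 ≤ j → j ≤ length (stripZeros xs) → sum (take j (stripZeros ys)) ≤ sum (take j (stripZeros xs))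
  prefix≤ j _ _ = subst₂ _≤_ (sym (sum-take-stripZeros ys j)) (sym (sum-take-stripZeros xs j)) (ys≼xs j)

T⇒≡true : ∀ {b} → T b → b ≡ true
T⇒≡true {true} _ = refl

¬T⇒≡false : ∀ {b} → ¬ T b → b ≡ false
¬T⇒≡false {true}  ¬b = ⊥-elim (¬b _)
¬T⇒≡false {false} _  = refl

≤ᵇ≡true⇒≤ : ∀ {m n} → (m ≤ᵇ n) ≡ true → m ≤ n
≤ᵇ≡true⇒≤ {m} {n} m≤ᵇn = ≤ᵇ⇒≤ m n (subst T (sym m≤ᵇn) _)

≤ᵇ≡false⇒> : ∀ {m n} → (m ≤ᵇ n) ≡ false → n < m
≤ᵇ≡false⇒> m≰ᵇn = ≰⇒> (λ m≤n → subst T m≰ᵇn (≤⇒≤ᵇ m≤n))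

indicator : Bool → ℕ
indicator true  = 1
indicator false = 0

indicator-≤-1 : ∀ b → indicator b ≤ 1
indicator-≤-1 true  = ≤-refl
indicator-≤-1 false = z≤n

indicator-true : ∀ {b} → T b → indicator b ≡ 1
indicator-true {true} _ = refl

indicator-false : ∀ {b} → ¬ T b → indicator b ≡ 0
indicator-false {true}  ¬b = ⊥-elim (¬b _)
indicator-false {false} _  = refl

indicator-mono : ∀ {b c} → (T b → T c) → indicator b ≤ indicator c
indicator-mono {true}  b⇒c = ≤-reflexive (sym (indicator-true (b⇒c _)))
indicator-mono {false} _   = z≤n

indicator-≤ᵇ-suc : ∀ x w → indicator (x ≤ᵇ w) + indicator (x ≡ᵇ suc w) ≡ indicator (x ≤ᵇ suc w)
indicator-≤ᵇ-suc zero    w = refl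
indicator-≤ᵇ-suc (suc x) w = go x w
  where
  go : ∀ x w → indicator (x <ᵇ w) + indicator (x ≡ᵇ w) ≡ indicator (x <ᵇ suc w)
  go zero    zero    = refl
  go zero    (suc w) = refl
  go (suc x) zero    = refl
  go (suc x) (suc w) = go x w

countBelow : (ℕ → Bool) → ℕ → ℕ
countBelow f m = length (filter (T? ∘ f) (upTo m))

countBelow-suc : ∀ f m → countBelow f (suc m) ≡ countBelow f m + indicator (f m)
countBelow-suc f m = begin
  length (filter P (upTo (suc m)))                      ≡⟨ cong (length ∘ filter P) (sym (upTo-∷ʳ m)) ⟩
  length (filter P (upTo m ++ m ∷ []))                  ≡⟨ cong length (filter-++ P (upTo m) (m ∷ [])) ⟩
  length (filter P (upTo m) ++ filter P (m ∷ []))       ≡⟨ length-++ (filter P (upTo m)) ⟩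
  countBelow f m + length (filter P (m ∷ []))           ≡⟨ cong (countBelow f m +_) last≡ ⟩
  countBelow f m + indicator (f m)                      ∎
  where
  open ≡-Reasoning
  P = T? ∘ f
  last≡ : length (filter P (m ∷ [])) ≡ indicator (f m)
  last≡ with f m
  ... | true  = refl
  ... | false = refl

countBelow-≤ : ∀ f m → countBelow f m ≤ m
countBelow-≤ f zero    = z≤n
countBelow-≤ f (suc m) = begin
  countBelow f (suc m)               ≡⟨ countBelow-suc f m ⟩
  countBelow f m + indicator (f m)   ≤⟨ +-mono-≤ (countBelow-≤ f m) (indicator-≤-1 (f m)) ⟩
  m + 1                              ≡⟨ +-comm m 1 ⟩
  suc m                              ∎
  where open ≤-Reasoning

≤-countBelow : ∀ f {m A} → A ≤ m → (∀ q → q < A → T (f q)) → A ≤ countBelow f m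
≤-countBelow f {zero}  A≤m _  = A≤m
≤-countBelow f {suc m} {A} A≤m fq with m≤n⇒m<n∨m≡n A≤m
... | inj₁ A<1+m = ≤-trans (≤-countBelow f (≤-pred A<1+m) fq)
                           (subst (countBelow f m ≤_) (sym (countBelow-suc f m)) (m≤m+n _ _))
... | inj₂ refl = begin
  suc m                               ≤⟨ s≤s (≤-countBelow f ≤-refl (λ q q<m → fq q (m<n⇒m<1+n q<m))) ⟩
  suc (countBelow f m)                ≡⟨ +-comm 1 _ ⟩
  countBelow f m + 1                  ≡⟨ cong (countBelow f m +_) (sym (indicator-true (fq m ≤-refl))) ⟩
  countBelow f m + indicator (f m)    ≡⟨ sym (countBelow-suc f m) ⟩
  countBelow f (suc m)                ∎
  where open ≤-Reasoning

countBelow-≤-bound : ∀ f {m A} → (∀ q → A ≤ q → q < m → ¬ T (f q)) → countBelow f m ≤ A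
countBelow-≤-bound f {zero}  _ = z≤n
countBelow-≤-bound f {suc m} {A} ¬fq with A ≤? m
... | no A≰m  = ≤-trans (countBelow-≤ f (suc m)) (≰⇒> A≰m)
... | yes A≤m = begin
  countBelow f (suc m)               ≡⟨ countBelow-suc f m ⟩
  countBelow f m + indicator (f m)   ≡⟨ cong (countBelow f m +_) (indicator-false (¬fq m A≤m ≤-refl)) ⟩
  countBelow f m + 0                 ≡⟨ +-identityʳ _ ⟩
  countBelow f m                     ≤⟨ countBelow-≤-bound f (λ q A≤q q<m → ¬fq q A≤q (m<n⇒m<1+n q<m)) ⟩
  A                                  ∎
  where open ≤-Reasoning

countBelow-exact : ∀ f {m A} → A ≤ m → (∀ q → q < m → (T (f q) → q < A) × (q < A → T (f q))) →
                   countBelow f m ≡ A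
countBelow-exact f {m} A≤m f⇔<A = ≤-antisym
  (countBelow-≤-bound f (λ q A≤q q<m fq → <⇒≱ (proj₁ (f⇔<A q q<m) fq) A≤q))
  (≤-countBelow f A≤m (λ q q<A → proj₂ (f⇔<A q (<-≤-trans q<A A≤m)) q<A))

countBelow-all : ∀ f m → (∀ q → q < m → T (f q)) → countBelow f m ≡ m
countBelow-all f m fq = ≤-antisym (countBelow-≤ f m) (≤-countBelow f ≤-refl fq)

countBelow-mono : ∀ f g m → (∀ q → q < m → T (f q) → T (g q)) → countBelow f m ≤ countBelow g m
countBelow-mono f g zero    f⇒g = z≤n
countBelow-mono f g (suc m) f⇒g = begin
  countBelow f (suc m)               ≡⟨ countBelow-suc f m ⟩
  countBelow f m + indicator (f m)   ≤⟨ +-mono-≤ (countBelow-mono f g m (λ q q<m → f⇒g q (m<n⇒m<1+n q<m)))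
                                                 (indicator-mono (f⇒g m ≤-refl)) ⟩
  countBelow g m + indicator (g m)   ≡⟨ sym (countBelow-suc g m) ⟩
  countBelow g (suc m)               ∎
  where open ≤-Reasoning

countBelow-+ : ∀ f g h m → (∀ q → q < m → indicator (f q) + indicator (g q) ≡ indicator (h q)) →
               countBelow f m + countBelow g m ≡ countBelow h m
countBelow-+ f g h zero    _  = refl
countBelow-+ f g h (suc m) f+g≡h = begin
  countBelow f (suc m) + countBelow g (suc m)
    ≡⟨ cong₂ _+_ (countBelow-suc f m) (countBelow-suc g m) ⟩
  countBelow f m + indicator (f m) + (countBelow g m + indicator (g m))
    ≡⟨ interchange (countBelow f m) _ _ _ ⟩
  countBelow f m + countBelow g m + (indicator (f m) + indicator (g m))
    ≡⟨ cong₂ _+_ (countBelow-+ f g h m (λ q q<m → f+g≡h q (m<n⇒m<1+n q<m))) (f+g≡h m ≤-refl) ⟩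
  countBelow h m + indicator (h m)
    ≡⟨ sym (countBelow-suc h m) ⟩
  countBelow h (suc m)
    ∎
  where open ≡-Reasoning

DownClosedBelow : (ℕ → Bool) → ℕ → Set
DownClosedBelow f m = ∀ q → suc q < m → T (f (suc q)) → T (f q)

downClosed-≤ : ∀ {f m} → DownClosedBelow f m → ∀ {q q'} → q ≤ q' → q' < m → T (f q') → T (f q)
downClosed-≤ closed q≤q' q'<m fq' with m≤n⇒m<n∨m≡n q≤q'
downClosed-≤ closed {q' = suc r} _ r+1<m fq' | inj₁ (s≤s q≤r) =
  downClosed-≤ closed q≤r (<-trans (n<1+n r) r+1<m) (closed r r+1<m fq')
... | inj₂ refl = fq'

countBelow-downClosed : ∀ f {m} → DownClosedBelow f m → ∀ {q} → q < m →
                        (T (f q) → q < countBelow f m) × (q < countBelow f m → T (f q))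
countBelow-downClosed f {m} closed {q} q<m = fwd , bwd
  where
  fwd : T (f q) → q < countBelow f m
  fwd fq = ≤-countBelow f q<m (λ q' q'<1+q → downClosed-≤ closed (≤-pred q'<1+q) q<m fq)
  bwd : q < countBelow f m → T (f q)
  bwd q<count with T? (f q)
  ... | yes fq = fq
  ... | no ¬fq = ⊥-elim (<⇒≱ q<count
          (countBelow-≤-bound f (λ q' q≤q' q'<m fq' → ¬fq (downClosed-≤ closed q≤q' q'<m fq'))))

maxUpTo : (ℕ → ℕ) → ℕ → ℕ
maxUpTo G k = foldr _⊔_ 0 (applyUpTo G k)

≤-maxUpTo : ∀ G {k i} → i < k → G i ≤ maxUpTo G k
≤-maxUpTo G {suc k} {zero}  _         = m≤m⊔n (G 0) _
≤-maxUpTo G {suc k} {suc i} (s≤s i<k) = ≤-trans (≤-maxUpTo (G ∘ suc) i<k) (m≤n⊔m (G 0) _)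

maxUpTo-attained : ∀ G k → maxUpTo G k ≡ 0 ⊎ Σ ℕ λ i → i < k × maxUpTo G k ≡ G i
maxUpTo-attained G zero = inj₁ refl
maxUpTo-attained G (suc k) with ⊔-sel (G 0) (maxUpTo (G ∘ suc) k)
... | inj₁ max≡G0 = inj₂ (0 , z<s , max≡G0)
... | inj₂ max≡rest with maxUpTo-attained (G ∘ suc) k
...   | inj₁ rest≡0            = inj₁ (trans max≡rest rest≡0)
...   | inj₂ (i , i<k , rest≡) = inj₂ (suc i , s≤s i<k , trans max≡rest rest≡)

largestFailure : (E : ℕ → Set) → (∀ v → Dec (E v)) → ∀ h →
                 (∀ v → 1 ≤ v → v ≤ h → E v) ⊎
                 (Σ ℕ λ v → 1 ≤ v × v ≤ h × (∀ v' → v < v' → v' ≤ h → E v') × ¬ E v)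
largestFailure E E? h = go h ≤-refl (λ v' h<v' v'≤h → ⊥-elim (<⇒≱ h<v' v'≤h))
  where
  Result : Set
  Result = (∀ v → 1 ≤ v → v ≤ h → E v) ⊎
           (Σ ℕ λ v → 1 ≤ v × v ≤ h × (∀ v' → v < v' → v' ≤ h → E v') × ¬ E v)
  go : ∀ v → v ≤ h → (∀ v' → v < v' → v' ≤ h → E v') → Result
  go zero    _     above = inj₁ above
  go (suc v) 1+v≤h above with E? (suc v)
  ... | no ¬E = inj₂ (suc v , s≤s z≤n , 1+v≤h , above , ¬E)
  ... | yes E₁₊ᵥ = go v (≤-trans (n≤1+n v) 1+v≤h) above'
    where
    above' : ∀ v' → v < v' → v' ≤ h → E v'
    above' v' v<v' v'≤h with m≤n⇒m<n∨m≡n v<v'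
    ... | inj₁ 1+v<v' = above v' 1+v<v' v'≤h
    ... | inj₂ refl   = E₁₊ᵥ

data SubsetSum : ℕ → List ℕ → ℕ → Set where
  []   : SubsetSum 0 [] 0
  skip : ∀ {j b s x} → SubsetSum j b s → SubsetSum j (x ∷ b) s
  pick : ∀ {j b s x} → SubsetSum j b s → SubsetSum (suc j) (x ∷ b) (x + s)

subsetSum-zero : ∀ {b s} → SubsetSum 0 b s → s ≡ 0
subsetSum-zero []        = refl
subsetSum-zero (skip js) = subsetSum-zero js

subsetSum-≤-sum : ∀ {j b s} → SubsetSum j b s → s ≤ sum b
subsetSum-≤-sum []                  = z≤n
subsetSum-≤-sum {b = x ∷ b} (skip js) = ≤-trans (subsetSum-≤-sum js) (m≤n+m _ x)
subsetSum-≤-sum (pick js)           = +-monoʳ-≤ _ (subsetSum-≤-sum js)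

Descending : List ℕ → Set
Descending = AllPairs _≥_

insertDesc-bounded : ∀ {y} x ys → x ≤ y → All (_≤ y) ys → All (_≤ y) (insertDesc x ys)
insertDesc-bounded x []       x≤y []       = x≤y ∷ []
insertDesc-bounded x (z ∷ zs) x≤y (z≤y ∷ zs≤y) with z ≤ᵇ x
... | true  = x≤y ∷ z≤y ∷ zs≤y
... | false = z≤y ∷ insertDesc-bounded x zs x≤y zs≤y

insertDesc-descending : ∀ x ys → Descending ys → Descending (insertDesc x ys)
insertDesc-descending x []       []                 = [] ∷ []
insertDesc-descending x (y ∷ ys) (ys≤y ∷ ys-desc) with y ≤ᵇ x in y≤ᵇx
... | true  = (y≤x ∷ All.map (λ z≤y → ≤-trans z≤y y≤x) ys≤y) ∷ ys≤y ∷ ys-desc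
  where y≤x = ≤ᵇ≡true⇒≤ y≤ᵇx
... | false = insertDesc-bounded x ys (<⇒≤ (≤ᵇ≡false⇒> y≤ᵇx)) ys≤y ∷ insertDesc-descending x ys ys-desc

lam-descending : ∀ a → Descending (lam a)
lam-descending []      = []
lam-descending (x ∷ a) = insertDesc-descending x (lam a) (lam-descending a)

sum-take-suc-≤ : ∀ {x} k ys → All (_≤ x) ys → sum (take (suc k) ys) ≤ x + sum (take k ys)
sum-take-suc-≤     k       []       _             = z≤n
sum-take-suc-≤     zero    (y ∷ ys) (y≤x ∷ _)     = +-monoˡ-≤ 0 y≤x
sum-take-suc-≤ {x} (suc k) (y ∷ ys) (_ ∷ ys≤x)    = begin
  y + sum (take (suc k) ys)   ≤⟨ +-monoʳ-≤ y (sum-take-suc-≤ k ys ys≤x) ⟩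
  y + (x + sum (take k ys))   ≡⟨ x∙yz≈y∙xz y x _ ⟩
  x + (y + sum (take k ys))   ∎
  where open ≤-Reasoning

sum-take-insertDesc-≥ : ∀ x j ys → Descending ys → sum (take j ys) ≤ sum (take j (insertDesc x ys))
sum-take-insertDesc-≥ x zero    ys       _                  = z≤n
sum-take-insertDesc-≥ x (suc j) []       _                  = z≤n
sum-take-insertDesc-≥ x (suc j) (y ∷ ys) (ys≤y ∷ ys-desc) with y ≤ᵇ x in y≤ᵇx
... | true  = sum-take-suc-≤ j (y ∷ ys) (y≤x ∷ All.map (λ z≤y → ≤-trans z≤y y≤x) ys≤y)
  where y≤x = ≤ᵇ≡true⇒≤ y≤ᵇx
... | false = +-monoʳ-≤ y (sum-take-insertDesc-≥ x j ys ys-desc)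

sum-take-insertDesc-≥-+ : ∀ x j ys → x + sum (take j ys) ≤ sum (take (suc j) (insertDesc x ys))
sum-take-insertDesc-≥-+ x j []       = ≤-refl
sum-take-insertDesc-≥-+ x j (y ∷ ys) with y ≤ᵇ x in y≤ᵇx
... | true = ≤-refl
sum-take-insertDesc-≥-+ x zero    (y ∷ ys) | false = +-monoˡ-≤ 0 (<⇒≤ (≤ᵇ≡false⇒> y≤ᵇx))
sum-take-insertDesc-≥-+ x (suc j) (y ∷ ys) | false = begin
  x + (y + sum (take j ys))                      ≡⟨ x∙yz≈y∙xz x y _ ⟩
  y + (x + sum (take j ys))                      ≤⟨ +-monoʳ-≤ y (sum-take-insertDesc-≥-+ x j ys) ⟩
  y + sum (take (suc j) (insertDesc x ys))       ∎
  where open ≤-Reasoning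

subsetSum-≤-sum-take-lam : ∀ {j b s} → SubsetSum j b s → s ≤ sum (take j (lam b))
subsetSum-≤-sum-take-lam [] = z≤n
subsetSum-≤-sum-take-lam {j} {x ∷ b} (skip js) =
  ≤-trans (subsetSum-≤-sum-take-lam js) (sum-take-insertDesc-≥ x j (lam b) (lam-descending b))
subsetSum-≤-sum-take-lam {suc j} {x ∷ b} (pick js) =
  ≤-trans (+-monoʳ-≤ x (subsetSum-≤-sum-take-lam js)) (sum-take-insertDesc-≥-+ x j (lam b))

subsetSum-dropLast : ∀ {j s} b → SubsetSum j (dropLast b) s → SubsetSum j b s
subsetSum-dropLast []          js        = js
subsetSum-dropLast (x ∷ [])    []        = skip []
subsetSum-dropLast (x ∷ y ∷ b) (skip js) = skip (subsetSum-dropLast (y ∷ b) js)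
subsetSum-dropLast (x ∷ y ∷ b) (pick js) = pick (subsetSum-dropLast (y ∷ b) js)

subsetSum-dropLast-lastOr0 : ∀ {j s} b → 0 < length b → SubsetSum j (dropLast b) s →
                             SubsetSum (suc j) b (s + lastOr0 b)
subsetSum-dropLast-lastOr0 (x ∷ [])    _ []        = subst (SubsetSum 1 (x ∷ [])) (+-comm x 0) (pick [])
subsetSum-dropLast-lastOr0 (x ∷ y ∷ b) _ (skip js) = skip (subsetSum-dropLast-lastOr0 (y ∷ b) z<s js)
subsetSum-dropLast-lastOr0 (x ∷ y ∷ b) _ (pick {s = s} js) =
  subst (SubsetSum _ (x ∷ y ∷ b)) (sym (+-assoc x s (lastOr0 (y ∷ b)))) (pick (subsetSum-dropLast-lastOr0 (y ∷ b) z<s js))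

subsetSum-none : ∀ b → SubsetSum 0 b 0
subsetSum-none []      = []
subsetSum-none (x ∷ b) = skip (subsetSum-none b)

subsetSum-lastOr0 : ∀ b → 0 < length b → SubsetSum 1 b (lastOr0 b)
subsetSum-lastOr0 b 0<len = subsetSum-dropLast-lastOr0 b 0<len (subsetSum-none (dropLast b))

sum-dropLast : ∀ b → sum (dropLast b) + lastOr0 b ≡ sum b
sum-dropLast []          = refl
sum-dropLast (x ∷ [])    = sym (+-identityʳ x)
sum-dropLast (x ∷ y ∷ b) = trans (+-assoc x _ _) (cong (x +_) (sum-dropLast (y ∷ b)))

length-dropLast : ∀ b → length (dropLast b) ≡ length b ∸ 1
length-dropLast []          = refl
length-dropLast (x ∷ [])    = refl
length-dropLast (x ∷ y ∷ b) = cong suc (length-dropLast (y ∷ b))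

nth-dropLast : ∀ b {j} → j < length (dropLast b) → nth (dropLast b) j ≡ nth b j
nth-dropLast (x ∷ y ∷ b) {zero}  _         = refl
nth-dropLast (x ∷ y ∷ b) {suc j} (s≤s j<len) = nth-dropLast (y ∷ b) j<len

lastOr0≡nth : ∀ b → lastOr0 b ≡ nth b (length b ∸ 1)
lastOr0≡nth []          = refl
lastOr0≡nth (x ∷ [])    = refl
lastOr0≡nth (x ∷ y ∷ b) = lastOr0≡nth (y ∷ b)

positive-dropLast : ∀ b → Positive b → Positive (dropLast b)
positive-dropLast []          _          = []
positive-dropLast (x ∷ [])    _          = []
positive-dropLast (x ∷ y ∷ b) (x>0 ∷ pos) = x>0 ∷ positive-dropLast (y ∷ b) pos

positive-lastOr0 : ∀ b → 0 < length b → Positive b → 0 < lastOr0 b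
positive-lastOr0 (x ∷ [])    _ (x>0 ∷ _) = x>0
positive-lastOr0 (x ∷ y ∷ b) _ (_ ∷ pos) = positive-lastOr0 (y ∷ b) z<s pos

lastOr0-nonEmpty : ∀ b → 0 < lastOr0 b → 0 < length b
lastOr0-nonEmpty []      ()
lastOr0-nonEmpty (x ∷ b) _ = z<s

length-aSeq : ∀ a i → length (aSeq a i) ≡ length a ∸ i
length-aSeq a zero    = refl
length-aSeq a (suc i) = begin
  length (dropLast (aSeq a i))   ≡⟨ length-dropLast (aSeq a i) ⟩
  length (aSeq a i) ∸ 1          ≡⟨ cong (_∸ 1) (length-aSeq a i) ⟩
  length a ∸ i ∸ 1               ≡⟨ ∸-+-assoc (length a) i 1 ⟩
  length a ∸ (i + 1)             ≡⟨ cong (length a ∸_) (+-comm i 1) ⟩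
  length a ∸ suc i               ∎
  where open ≡-Reasoning

nth-aSeq : ∀ a i {j} → j < length (aSeq a i) → nth (aSeq a i) j ≡ nth a j
nth-aSeq a zero    j<len = refl
nth-aSeq a (suc i) j<len = trans (nth-dropLast (aSeq a i) j<len) (nth-aSeq a i (<-≤-trans j<len len≤))
  where
  len≤ : length (dropLast (aSeq a i)) ≤ length (aSeq a i)
  len≤ = subst (_≤ length (aSeq a i)) (sym (length-dropLast (aSeq a i))) (m∸n≤m (length (aSeq a i)) 1)

positive-aSeq : ∀ a i → Positive a → Positive (aSeq a i)
positive-aSeq a zero    pos = pos
positive-aSeq a (suc i) pos = positive-dropLast (aSeq a i) (positive-aSeq a i pos)

nonEmpty-aSeq : ∀ a {i} → i < length a → 0 < length (aSeq a i)
nonEmpty-aSeq a {i} i<len = subst (0 <_) (sym (length-aSeq a i)) (m<n⇒0<n∸m i<len)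

lastOr0-aSeq : ∀ a {w} → w < length a → lastOr0 (aSeq a (length a ∸ suc w)) ≡ nth a w
lastOr0-aSeq a {w} w<len = begin
  lastOr0 as                     ≡⟨ lastOr0≡nth as ⟩
  nth as (length as ∸ 1)         ≡⟨ cong (λ l → nth as (l ∸ 1)) length-as ⟩
  nth as w                       ≡⟨ nth-aSeq a (length a ∸ suc w) (subst (w <_) (sym length-as) ≤-refl) ⟩
  nth a w                        ∎
  where
  open ≡-Reasoning
  as = aSeq a (length a ∸ suc w)
  length-as : length as ≡ suc w
  length-as = trans (length-aSeq a (length a ∸ suc w)) (m∸[m∸n]≡n w<len)

sum-aSeq-length : ∀ a → sum (aSeq a (length a)) ≡ 0
sum-aSeq-length a = begin
  sum (aSeq a (length a))
    ≡⟨ sum-nth (aSeq a (length a)) ⟩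
  sumBelow (nth (aSeq a (length a))) (length (aSeq a (length a)))
    ≡⟨ cong (sumBelow _) (trans (length-aSeq a (length a)) (n∸n≡0 (length a))) ⟩
  0
    ∎
  where open ≡-Reasoning

m∸[o∸n]+o≡m+n : ∀ {m n o} → n ≤ o → o ≤ m → m ∸ (o ∸ n) + o ≡ m + n
m∸[o∸n]+o≡m+n {m} {n} {o} n≤o o≤m = begin
  m ∸ (o ∸ n) + o                ≡⟨ cong (m ∸ (o ∸ n) +_) (sym (m∸n+n≡m n≤o)) ⟩
  m ∸ (o ∸ n) + (o ∸ n + n)      ≡⟨ sym (+-assoc (m ∸ (o ∸ n)) (o ∸ n) n) ⟩
  m ∸ (o ∸ n) + (o ∸ n) + n      ≡⟨ cong (_+ n) (m∸n+n≡m (≤-trans (m∸n≤m o n) o≤m)) ⟩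
  m + n                          ∎
  where open ≡-Reasoning

module _ (M b : List ℕ) (0<c : 0 < lastOr0 b) where
  private
    c = lastOr0 b

    fits : ℕ → ℕ
    fits i = if c ≤ᵇ nth M i then suc i else 0

    fits-≤ : ∀ {i} → c ≤ nth M i → fits i ≡ suc i
    fits-≤ {i} c≤Mᵢ = cong (λ β → if β then suc i else 0) (T⇒≡true (≤⇒≤ᵇ c≤Mᵢ))

    fits-≰ : ∀ {i} → ¬ c ≤ nth M i → fits i ≡ 0
    fits-≰ {i} c≰Mᵢ = cong (λ β → if β then suc i else 0) (¬T⇒≡false (c≰Mᵢ ∘ ≤ᵇ⇒≤ c (nth M i)))

    fits⇒< : ∀ {i} → c ≤ nth M i → suc i ≤ sIdx M b
    fits⇒< {i} c≤Mᵢ = subst (_≤ sIdx M b) (fits-≤ c≤Mᵢ) (≤-maxUpTo fits (≰⇒> outside⇒0))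
      where
      outside⇒0 : ¬ length M ≤ i
      outside⇒0 len≤i = <⇒≱ 0<c (subst (c ≤_) (nth-beyond M len≤i) c≤Mᵢ)

  sIdx-lastFitting : lastOr0 b ≤ nth M 0 →
                     ∃[ t ] sIdx M b ≡ suc t × lastOr0 b ≤ nth M t × nth M (suc t) < lastOr0 b
  sIdx-lastFitting c≤M₀ with maxUpTo-attained fits (length M)
  ... | inj₁ sIdx≡0 = ⊥-elim (<⇒≱ (fits⇒< c≤M₀) (≤-reflexive sIdx≡0))
  ... | inj₂ (t , _ , sIdx≡) with c ≤? nth M t
  ...   | no c≰Mₜ  = ⊥-elim (<⇒≱ (fits⇒< c≤M₀) (≤-reflexive (trans sIdx≡ (fits-≰ c≰Mₜ))))
  ...   | yes c≤Mₜ = t , sIdx≡suc , c≤Mₜ , ≰⇒> (λ c≤Mₜ₊₁ → <-irrefl (sym sIdx≡suc) (fits⇒< c≤Mₜ₊₁))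
    where
    sIdx≡suc : sIdx M b ≡ suc t
    sIdx≡suc = trans sIdx≡ (fits-≤ c≤Mₜ)

-- `dominates` is f ⊵ λ(b) stated without sorting: any j parts of b sum to at most f₀ + ⋯ + f_{j−1}.
record Admissible (f : ℕ → ℕ) (b : List ℕ) (K : ℕ) : Set where
  field
    antitone  : Antitone f
    vanishes  : VanishesFrom f K
    total     : sumBelow f K ≡ sum b
    dominates : ∀ {j s} → SubsetSum j b s → s ≤ sumBelow f j

module RemoveLast {M b : List ℕ} {K : ℕ} (adm : Admissible (nth M) b K) (0<c : 0 < lastOr0 b) where
  open Admissible adm

  private
    f = nth M
    g = nth (rho M b)
    c = lastOr0 b

    lastFitting = sIdx-lastFitting M b 0<c (dominates (subsetSum-lastOr0 b (lastOr0-nonEmpty b 0<c)))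
    t = proj₁ lastFitting

    sIdx≡ : sIdx M b ≡ suc t
    sIdx≡ = proj₁ (proj₂ lastFitting)

    c≤fₜ : c ≤ f t
    c≤fₜ = proj₁ (proj₂ (proj₂ lastFitting))

    fₜ₊₁<c : f (suc t) < c
    fₜ₊₁<c = proj₂ (proj₂ (proj₂ lastFitting))

    positive⇒< : ∀ {i L} → VanishesFrom f L → 0 < f i → i < L
    positive⇒< f≡0 0<fᵢ = ≰⇒> (λ L≤i → <⇒≢ 0<fᵢ (sym (f≡0 _ L≤i)))

    t<K : t < K
    t<K = positive⇒< vanishes (<-≤-trans 0<c c≤fₜ)

    t<len : t < length M
    t<len = positive⇒< (nth-vanishesFrom M) (<-≤-trans 0<c c≤fₜ)

    rhoPart≡ : ∀ i → rhoPart M b (suc i) ≡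
                     (if i <ᵇ t then f i else if i ≡ᵇ t then f i ∸ (c ∸ f (suc i)) else f (suc i))
    rhoPart≡ i rewrite sIdx≡ = refl

    g≡rhoPart : ∀ {i} → i < length M → g i ≡ rhoPart M b (suc i)
    g≡rhoPart {i} i<len = trans (nth-stripZeros (applyUpTo R (length M)) i) (nth-applyUpTo R i<len)
      where R = λ j → rhoPart M b (suc j)

    g-< : ∀ {i} → i < t → g i ≡ f i
    g-< {i} i<t rewrite g≡rhoPart (<-trans i<t t<len) | rhoPart≡ i | T⇒≡true (<⇒<ᵇ i<t) = refl

    g-≡ : g t ≡ f t ∸ (c ∸ f (suc t))
    g-≡ rewrite g≡rhoPart t<len | rhoPart≡ t
              | ¬T⇒≡false (<-irrefl refl ∘ <ᵇ⇒< t t) | T⇒≡true (≡⇒≡ᵇ t t refl) = refl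

    g-> : ∀ {i} → t < i → g i ≡ f (suc i)
    g-> {i} t<i with i <? length M
    ... | yes i<len rewrite g≡rhoPart i<len | rhoPart≡ i
                          | ¬T⇒≡false (<⇒≱ t<i ∘ <⇒≤ ∘ <ᵇ⇒< i t) | ¬T⇒≡false (<⇒≢ t<i ∘ sym ∘ ≡ᵇ⇒≡ i t) = refl
    ... | no i≮len = begin
      g i                                            ≡⟨ nth-stripZeros (applyUpTo (λ j → rhoPart M b (suc j)) (length M)) i ⟩
      nth (applyUpTo (λ j → rhoPart M b (suc j)) (length M)) i ≡⟨ nth-applyUpTo-beyond _ (≮⇒≥ i≮len) ⟩
      0                                              ≡⟨ sym (nth-beyond M (≤-trans (≮⇒≥ i≮len) (n≤1+n i))) ⟩
      f (suc i)                                      ∎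
      where open ≡-Reasoning

    gₜ+c : g t + c ≡ f t + f (suc t)
    gₜ+c = trans (cong (_+ c) g-≡) (m∸[o∸n]+o≡m+n (<⇒≤ fₜ₊₁<c) c≤fₜ)

  rho-≤ : ∀ p → g p ≤ f p
  rho-≤ p with <-cmp p t
  ... | tri< p<t _ _  = ≤-reflexive (g-< p<t)
  ... | tri≈ _ refl _ = subst (_≤ f t) (sym g-≡) (m∸n≤m (f t) (c ∸ f (suc t)))
  ... | tri> _ _ t<p  = subst (_≤ f p) (sym (g-> t<p)) (antitone p)

  ≤-rho : ∀ p → f (suc p) ≤ g p
  ≤-rho p with <-cmp p t
  ... | tri< p<t _ _  = subst (f (suc p) ≤_) (sym (g-< p<t)) (antitone p)
  ... | tri≈ _ refl _ = +-cancelʳ-≤ c _ _ (begin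
    f (suc t) + c        ≤⟨ +-monoʳ-≤ (f (suc t)) c≤fₜ ⟩
    f (suc t) + f t      ≡⟨ +-comm (f (suc t)) (f t) ⟩
    f t + f (suc t)      ≡⟨ sym gₜ+c ⟩
    g t + c              ∎)
    where open ≤-Reasoning
  ... | tri> _ _ t<p  = ≤-reflexive (sym (g-> t<p))

  sumBelow-rho-≤ : ∀ {j} → j ≤ t → sumBelow g j ≡ sumBelow f j
  sumBelow-rho-≤ {j} j≤t = sumBelow-cong g f j (λ i i<j → g-< (<-≤-trans i<j j≤t))

  sumBelow-rho-> : ∀ {j} → t < j → sumBelow g j + c ≡ sumBelow f (suc j)
  sumBelow-rho-> {suc j} t<1+j with m≤n⇒m<n∨m≡n (≤-pred t<1+j)
  ... | inj₂ refl = begin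
    sumBelow g t + g t + c          ≡⟨ +-assoc (sumBelow g t) (g t) c ⟩
    sumBelow g t + (g t + c)        ≡⟨ cong₂ _+_ (sumBelow-rho-≤ ≤-refl) gₜ+c ⟩
    sumBelow f t + (f t + f (suc t)) ≡⟨ sym (+-assoc (sumBelow f t) _ _) ⟩
    sumBelow f (suc (suc t))        ∎
    where open ≡-Reasoning
  ... | inj₁ t<j = begin
    sumBelow g j + g j + c          ≡⟨ xy∙z≈xz∙y (sumBelow g j) (g j) c ⟩
    sumBelow g j + c + g j          ≡⟨ cong₂ _+_ (sumBelow-rho-> t<j) (g-> t<j) ⟩
    sumBelow f (suc (suc j))        ∎
    where open ≡-Reasoning

  rho-vanishes : VanishesFrom g K
  rho-vanishes i K≤i = trans (g-> (<-≤-trans t<K K≤i)) (vanishes (suc i) (≤-trans K≤i (n≤1+n i)))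

  rho-total : sumBelow g K + c ≡ sumBelow f K
  rho-total = begin
    sumBelow g K + c                ≡⟨ sumBelow-rho-> t<K ⟩
    sumBelow f K + f K              ≡⟨ cong (sumBelow f K +_) (vanishes K ≤-refl) ⟩
    sumBelow f K + 0                ≡⟨ +-identityʳ _ ⟩
    sumBelow f K                    ∎
    where open ≡-Reasoning

  rho-admissible : Admissible g (dropLast b) K
  rho-admissible = record
    { antitone  = λ p → ≤-trans (rho-≤ (suc p)) (≤-rho p)
    ; vanishes  = rho-vanishes
    ; total     = +-cancelʳ-≡ c _ _ (trans rho-total (trans total (sym (sum-dropLast b))))
    ; dominates = rho-dominates
    }
    where
    rho-dominates : ∀ {j s} → SubsetSum j (dropLast b) s → s ≤ sumBelow g j
    rho-dominates {j} {s} js with j ≤? t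
    ... | yes j≤t = subst (s ≤_) (sym (sumBelow-rho-≤ j≤t)) (dominates (subsetSum-dropLast b js))
    ... | no  j≰t = +-cancelʳ-≤ c _ _ (subst (s + c ≤_) (sym (sumBelow-rho-> (≰⇒> j≰t)))
                      (dominates (subsetSum-dropLast-lastOr0 b (lastOr0-nonEmpty b 0<c) js)))

  rho-dominates-interlacing : ∀ ν → (∀ p → ν p ≤ f p) → (∀ p → f (suc p) ≤ ν p) →
                              sumBelow ν K + c ≡ sumBelow f K → ∀ j → sumBelow ν j ≤ sumBelow g j
  rho-dominates-interlacing ν ν≤f f≤ν total-ν j with j ≤? t
  ... | yes j≤t = subst (sumBelow ν j ≤_) (sym (sumBelow-rho-≤ j≤t)) (sumBelow-mono ν f j (λ i _ → ν≤f i))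
  ... | no  j≰t = +-cancelʳ-≤ c _ _ (subst (sumBelow ν j + c ≤_) (sym (sumBelow-rho-> (≰⇒> j≰t)))
                    (sumBelow-interlacing f ν vanishes ν-vanishes f≤ν total-ν j))
    where
    ν-vanishes : VanishesFrom ν K
    ν-vanishes i K≤i = n≤0⇒n≡0 (subst (ν i ≤_) (vanishes i K≤i) (ν≤f i))

module Counting (μ : List ℕ) where

  boxesAtMost : Tableau → ℕ → ℕ → ℕ
  boxesAtMost R u = rowCount μ (λ x → x ≤ᵇ u) R

  RowsWeaklyIncreasing : Tableau → Set
  RowsWeaklyIncreasing R = ∀ p q → InD μ p (suc q) → R p q ≤ R p (suc q)

  boxesAtMost-beyond : ∀ R u {p} → length μ ≤ p → boxesAtMost R u p ≡ 0
  boxesAtMost-beyond R u {p} K≤p =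
    n≤0⇒n≡0 (subst (boxesAtMost R u p ≤_) (nth-beyond μ K≤p) (countBelow-≤ _ (nth μ p)))

  nth-tau : ∀ R u p → nth (tau μ R u) p ≡ boxesAtMost R u p
  nth-tau R u p with p <? length μ
  ... | yes p<K = nth-applyUpTo (boxesAtMost R u) p<K
  ... | no  p≮K = trans (nth-applyUpTo-beyond _ (≮⇒≥ p≮K)) (sym (boxesAtMost-beyond R u (≮⇒≥ p≮K)))

  tau-≡ : ∀ R S u → (∀ p → boxesAtMost R u p ≡ boxesAtMost S u p) → tau μ R u ≡ tau μ S u
  tau-≡ R S u R≡S = nth-injective _ _
    (trans (length-applyUpTo (boxesAtMost R u) (length μ)) (sym (length-applyUpTo (boxesAtMost S u) (length μ))))
    (λ p → trans (nth-tau R u p) (trans (R≡S p) (sym (nth-tau S u p))))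

  boxesAtMost-≡ : ∀ R S u → tau μ R u ≡ tau μ S u → ∀ p → boxesAtMost R u p ≡ boxesAtMost S u p
  boxesAtMost-≡ R S u R≡S p = trans (sym (nth-tau R u p)) (trans (cong (λ l → nth l p) R≡S) (nth-tau S u p))

  boxesAtMost-prefix : ∀ R → RowsWeaklyIncreasing R → ∀ u {p q} → q < nth μ p →
                       (R p q ≤ u → q < boxesAtMost R u p) × (q < boxesAtMost R u p → R p q ≤ u)
  boxesAtMost-prefix R rows u {p} {q} q<μₚ with countBelow-downClosed (λ q → R p q ≤ᵇ u) closed q<μₚ
    where
    closed : DownClosedBelow (λ q → R p q ≤ᵇ u) (nth μ p)
    closed q q+1<μₚ Rq+1≤u = ≤⇒≤ᵇ (≤-trans (rows p q q+1<μₚ) (≤ᵇ⇒≤ _ _ Rq+1≤u))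
  ... | to , from = to ∘ ≤⇒≤ᵇ , ≤ᵇ⇒≤ _ _ ∘ from

  boxesAtMost-full : ∀ R {h} → (∀ p q → InD μ p q → R p q ≤ h) → ∀ p → boxesAtMost R h p ≡ nth μ p
  boxesAtMost-full R R≤h p = countBelow-all _ (nth μ p) (λ q q<μₚ → ≤⇒≤ᵇ (R≤h p q q<μₚ))

  boxesAtMost-mono : ∀ R {u u'} → u ≤ u' → ∀ p → boxesAtMost R u p ≤ boxesAtMost R u' p
  boxesAtMost-mono R {u} u≤u' p =
    countBelow-mono _ _ (nth μ p) (λ q _ Rpq≤u → ≤⇒≤ᵇ (≤-trans (≤ᵇ⇒≤ (R p q) u Rpq≤u) u≤u'))

  boxesAtMost-column : ∀ R → RowsWeaklyIncreasing R → (∀ p q → InD μ (suc p) q → R p q < R (suc p) q) →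
                       Antitone (nth μ) → ∀ v p → boxesAtMost R (suc v) (suc p) ≤ boxesAtMost R v p
  boxesAtMost-column R rows columns μ-antitone v p =
    ≤-countBelow _ (≤-trans (countBelow-≤ _ (nth μ (suc p))) (μ-antitone p)) (λ q q<A → ≤⇒≤ᵇ (above≤v q q<A))
    where
    above≤v : ∀ q → q < boxesAtMost R (suc v) (suc p) → R p q ≤ v
    above≤v q q<A = ≤-pred (<-≤-trans (columns p q q<μₚ₊₁) (proj₂ (boxesAtMost-prefix R rows (suc v) q<μₚ₊₁) q<A))
      where
      q<μₚ₊₁ : q < nth μ (suc p)
      q<μₚ₊₁ = <-≤-trans q<A (countBelow-≤ _ _)

  sumBelow-boxesAtMost-suc : ∀ R w → sumBelow (boxesAtMost R w) (length μ) + weightOf μ R (suc w) ≡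
                                     sumBelow (boxesAtMost R (suc w)) (length μ)
  sumBelow-boxesAtMost-suc R w = begin
    sumBelow (boxesAtMost R w) K + weightOf μ R (suc w)
      ≡⟨ cong (sumBelow (boxesAtMost R w) K +_) (sum-applyUpTo _ K) ⟩
    sumBelow (boxesAtMost R w) K + sumBelow (rowCount μ (λ x → x ≡ᵇ suc w) R) K
      ≡⟨ sym (sumBelow-+ (boxesAtMost R w) _ K) ⟩
    sumBelow (λ p → boxesAtMost R w p + rowCount μ (λ x → x ≡ᵇ suc w) R p) K
      ≡⟨ sumBelow-cong _ _ K (λ p _ → countBelow-+ _ _ _ (nth μ p) (λ q _ → indicator-≤ᵇ-suc (R p q) w)) ⟩
    sumBelow (boxesAtMost R (suc w)) K
      ∎
    where
    open ≡-Reasoning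
    K = length μ

  tau-injective : ∀ R S {h} → RowsWeaklyIncreasing R → RowsWeaklyIncreasing S →
                  (∀ p q → InD μ p q → 1 ≤ R p q × R p q ≤ h) → (∀ p q → InD μ p q → 1 ≤ S p q × S p q ≤ h) →
                  (∀ u → 1 ≤ u → u ≤ h → tau μ R u ≡ tau μ S u) → ∀ p q → InD μ p q → R p q ≡ S p q
  tau-injective R S rowsR rowsS rangeR rangeS agree p q q<μₚ =
    ≤-antisym (entry-≤ R S rowsR rowsS rangeS agree)
              (entry-≤ S R rowsS rowsR rangeR (λ u 1≤u u≤h → sym (agree u 1≤u u≤h)))
    where
    entry-≤ : ∀ R S {h} → RowsWeaklyIncreasing R → RowsWeaklyIncreasing S →
              (∀ p q → InD μ p q → 1 ≤ S p q × S p q ≤ h) →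
              (∀ u → 1 ≤ u → u ≤ h → tau μ R u ≡ tau μ S u) → R p q ≤ S p q
    entry-≤ R S rowsR rowsS rangeS agree = proj₂ (boxesAtMost-prefix R rowsR u q<μₚ)
      (subst (q <_) (sym (boxesAtMost-≡ R S u (agree u (proj₁ (rangeS p q q<μₚ)) (proj₂ (rangeS p q q<μₚ))) p))
                    (proj₁ (boxesAtMost-prefix S rowsS u q<μₚ) ≤-refl))
      where u = S p q

levelFrom-stop : ∀ μ a {p q i r} → q < nth (rhoSeq μ a i) p → nth (rhoSeq μ a (suc i)) p ≤ q →
                 levelFrom μ a p q i (suc r) ≡ length a ∸ i
levelFrom-stop μ a {p} {q} {i} q<ρᵢ ρᵢ₊₁≤q
  rewrite T⇒≡true (<⇒<ᵇ q<ρᵢ) | ¬T⇒≡false (λ q<ρᵢ₊₁ → <⇒≱ (<ᵇ⇒< q _ q<ρᵢ₊₁) ρᵢ₊₁≤q) = refl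

levelFrom-continue : ∀ μ a {p q i r} → q < nth (rhoSeq μ a i) p → q < nth (rhoSeq μ a (suc i)) p →
                     levelFrom μ a p q i (suc r) ≡ levelFrom μ a p q (suc i) r
levelFrom-continue μ a q<ρᵢ q<ρᵢ₊₁ rewrite T⇒≡true (<⇒<ᵇ q<ρᵢ) | T⇒≡true (<⇒<ᵇ q<ρᵢ₊₁) = refl

module Greedy {n : ℕ} {μ a : List ℕ} (μ⊢n : IsPartition μ n) (a⊨n : IsComposition a n) (μ⊵λa : μ ⊵ lam a) where
  open Counting μ

  private
    K = length μ
    h = length a

  ρ : ℕ → ℕ → ℕ
  ρ i = nth (rhoSeq μ a i)

  μ-admissible : Admissible (nth μ) a K
  μ-admissible = record
    { antitone  = antitone-nth (proj₂ μ⊢n)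
    ; vanishes  = nth-vanishesFrom μ
    ; total     = μ-total
    ; dominates = μ-dominates
    }
    where
    μ-total : sumBelow (nth μ) K ≡ sum a
    μ-total = trans (sym (sum-nth μ)) (trans (proj₂ (proj₁ μ⊢n)) (sym (proj₂ a⊨n)))
    μ-dominates : ∀ {j s} → SubsetSum j a s → s ≤ sumBelow (nth μ) j
    μ-dominates {zero}  js = ≤-reflexive (subsetSum-zero js)
    μ-dominates {suc j} js with suc j ≤? K
    ... | yes j<K = ≤-trans (subsetSum-≤-sum-take-lam js)
                            (subst (sum (take (suc j) (lam a)) ≤_) (sum-take μ (suc j)) (proj₂ μ⊵λa (suc j) (s≤s z≤n) j<K))
    ... | no  j≮K = ≤-trans (subsetSum-≤-sum js)
                            (subst (_≤ sumBelow (nth μ) (suc j)) μ-total (sumBelow-monoʳ (nth μ) (<⇒≤ (≰⇒> j≮K))))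

  lastPart-positive : ∀ {i} → i < h → 0 < lastOr0 (aSeq a i)
  lastPart-positive {i} i<h = positive-lastOr0 (aSeq a i) (nonEmpty-aSeq a i<h) (positive-aSeq a i (proj₁ a⊨n))

  admissible : ∀ i → i ≤ h → Admissible (ρ i) (aSeq a i) K
  admissible zero    _     = μ-admissible
  admissible (suc i) i<h = RemoveLast.rho-admissible {M = rhoSeq μ a i} (admissible i (<⇒≤ i<h)) (lastPart-positive i<h)

  module Step {i} (i<h : i < h) = RemoveLast {M = rhoSeq μ a i} (admissible i (<⇒≤ i<h)) (lastPart-positive i<h)

  ρ-vanishes : ∀ {i} → i ≤ h → VanishesFrom (ρ i) K
  ρ-vanishes {i} i≤h = Admissible.vanishes (admissible i i≤h)

  ρ-last≡0 : ∀ p → ρ h p ≡ 0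
  ρ-last≡0 p with p <? K
  ... | no  p≮K = ρ-vanishes ≤-refl p (≮⇒≥ p≮K)
  ... | yes p<K = n≤0⇒n≡0 (subst (ρ h p ≤_) total≡0 (≤-sumBelow (ρ h) p<K))
    where
    total≡0 : sumBelow (ρ h) K ≡ 0
    total≡0 = trans (Admissible.total (admissible h ≤-refl)) (sum-aSeq-length a)

  ρ-mono : ∀ p {i i'} → i ≤ i' → i' ≤ h → ρ i' p ≤ ρ i p
  ρ-mono p i≤i' i'≤h with m≤n⇒m<n∨m≡n i≤i'
  ρ-mono p {i' = suc k} _ k<h | inj₁ (s≤s i≤k) = ≤-trans (Step.rho-≤ k<h p) (ρ-mono p i≤k (<⇒≤ k<h))
  ... | inj₂ refl = ≤-refl

  Tg : Tableau
  Tg = greedyTab μ a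

  greedyTab-level : ∀ {p q} → q < nth μ p →
                    ∃[ j ] j < h × ρ (suc j) p ≤ q × q < ρ j p × Tg p q ≡ h ∸ j
  greedyTab-level {p} {q} = search 0 h refl
    where
    search : ∀ i r → i + r ≡ h → q < ρ i p →
             ∃[ j ] j < h × ρ (suc j) p ≤ q × q < ρ j p × levelFrom μ a p q i r ≡ h ∸ j
    search i zero    i+0≡h q<ρᵢ = ⊥-elim (<⇒≱ q<ρᵢ (≤-trans (≤-reflexive ρᵢ≡0) z≤n))
      where
      ρᵢ≡0 : ρ i p ≡ 0
      ρᵢ≡0 = trans (cong (λ x → ρ x p) (trans (sym (+-identityʳ i)) i+0≡h)) (ρ-last≡0 p)
    search i (suc r) i+1+r≡h q<ρᵢ with q <? ρ (suc i) p
    ... | no  q≮ρᵢ₊₁ = i , subst (i <_) i+1+r≡h (m<m+n i z<s) , ≮⇒≥ q≮ρᵢ₊₁ , q<ρᵢ ,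
                       levelFrom-stop μ a {p} {q} {i} {r} q<ρᵢ (≮⇒≥ q≮ρᵢ₊₁)
    ... | yes q<ρᵢ₊₁ with search (suc i) r (trans (sym (+-suc i r)) i+1+r≡h) q<ρᵢ₊₁
    ...   | j , j<h , ρⱼ₊₁≤q , q<ρⱼ , level≡ =
      j , j<h , ρⱼ₊₁≤q , q<ρⱼ , trans (levelFrom-continue μ a {p} {q} {i} {r} q<ρᵢ q<ρᵢ₊₁) level≡

  greedyTab-range : ∀ p q → InD μ p q → 1 ≤ Tg p q × Tg p q ≤ h
  greedyTab-range p q q<μₚ with greedyTab-level q<μₚ
  ... | j , j<h , _ , _ , Tg≡ = subst (1 ≤_) (sym Tg≡) (m<n⇒0<n∸m j<h) , subst (_≤ h) (sym Tg≡) (m∸n≤m h j)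

  greedyTab-≤ : ∀ {u} → u ≤ h → ∀ {p q} → q < nth μ p →
                (Tg p q ≤ u → q < ρ (h ∸ u) p) × (q < ρ (h ∸ u) p → Tg p q ≤ u)
  greedyTab-≤ {u} u≤h {p} {q} q<μₚ with greedyTab-level q<μₚ
  ... | j , j<h , ρⱼ₊₁≤q , q<ρⱼ , Tg≡ = to , from
    where
    to : Tg p q ≤ u → q < ρ (h ∸ u) p
    to Tg≤u = <-≤-trans q<ρⱼ (ρ-mono p h∸u≤j (<⇒≤ j<h))
      where
      h∸u≤j : h ∸ u ≤ j
      h∸u≤j = subst (h ∸ u ≤_) (m∸[m∸n]≡n (<⇒≤ j<h)) (∸-monoʳ-≤ h (subst (_≤ u) Tg≡ Tg≤u))
    from : q < ρ (h ∸ u) p → Tg p q ≤ u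
    from q<ρ with Tg p q ≤? u
    ... | yes Tg≤u = Tg≤u
    ... | no  Tg≰u = ⊥-elim (<⇒≱ q<ρ (≤-trans (ρ-mono p j<h∸u (m∸n≤m h u)) ρⱼ₊₁≤q))
      where
      j<h∸u : j < h ∸ u
      j<h∸u = subst (_< h ∸ u) (m∸[m∸n]≡n (<⇒≤ j<h)) (∸-monoʳ-< (subst (u <_) Tg≡ (≰⇒> Tg≰u)) (m∸n≤m h j))

  greedyTab-boxesAtMost : ∀ {u} → u ≤ h → ∀ p → boxesAtMost Tg u p ≡ ρ (h ∸ u) p
  greedyTab-boxesAtMost {u} u≤h p = countBelow-exact _ (ρ-mono p z≤n (m∸n≤m h u))
    (λ q q<μₚ → (proj₁ (greedyTab-≤ u≤h q<μₚ) ∘ ≤ᵇ⇒≤ _ _) , (≤⇒≤ᵇ ∘ proj₂ (greedyTab-≤ u≤h q<μₚ)))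

  greedyTab-rows : RowsWeaklyIncreasing Tg
  greedyTab-rows p q q+1<μₚ =
    proj₂ (greedyTab-≤ v≤h q<μₚ) (<-trans (n<1+n q) (proj₁ (greedyTab-≤ v≤h q+1<μₚ) ≤-refl))
    where
    v≤h = proj₂ (greedyTab-range p (suc q) q+1<μₚ)
    q<μₚ = <-trans (n<1+n q) q+1<μₚ

  greedyTab-columns : ∀ p q → InD μ (suc p) q → Tg p q < Tg (suc p) q
  greedyTab-columns p q q<μₚ₊₁ = below (Tg (suc p) q) refl (greedyTab-range (suc p) q q<μₚ₊₁)
    where
    q<μₚ : q < nth μ p
    q<μₚ = <-≤-trans q<μₚ₊₁ (Admissible.antitone μ-admissible p)
    below : ∀ v → Tg (suc p) q ≡ v → 1 ≤ v × v ≤ h → Tg p q < v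
    below (suc w) Tg≡ (_ , w<h) = s≤s (proj₂ (greedyTab-≤ (<⇒≤ w<h) q<μₚ) q<ρ)
      where
      q<ρ : q < ρ (h ∸ w) p
      q<ρ = subst (λ x → q < ρ x p) (sym (+-∸-assoc 1 w<h))
              (<-≤-trans (proj₁ (greedyTab-≤ w<h q<μₚ₊₁) (≤-reflexive Tg≡)) (Step.≤-rho (∸-monoʳ-< z<s w<h) p))

  sumBelow-ρ-step : ∀ {w} → w < h → sumBelow (ρ (h ∸ w)) K + nth a w ≡ sumBelow (ρ (h ∸ suc w)) K
  sumBelow-ρ-step {w} w<h = begin
    sumBelow (ρ (h ∸ w)) K + nth a w
      ≡⟨ cong₂ (λ x y → sumBelow (ρ x) K + y) (+-∸-assoc 1 w<h) (sym (lastOr0-aSeq a w<h)) ⟩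
    sumBelow (ρ (suc (h ∸ suc w))) K + lastOr0 (aSeq a (h ∸ suc w))
      ≡⟨ Step.rho-total (∸-monoʳ-< z<s w<h) ⟩
    sumBelow (ρ (h ∸ suc w)) K
      ∎
    where open ≡-Reasoning

  sumBelow-greedyTab : ∀ {u} → u ≤ h → sumBelow (boxesAtMost Tg u) K ≡ sumBelow (ρ (h ∸ u)) K
  sumBelow-greedyTab u≤h = sumBelow-cong _ _ K (λ p _ → greedyTab-boxesAtMost u≤h p)

  greedyTab-weight : ∀ v → 1 ≤ v → v ≤ h → weightOf μ Tg v ≡ nth a (v ∸ 1)
  greedyTab-weight (suc w) _ w<h = +-cancelˡ-≡ (sumBelow (ρ (h ∸ w)) K) _ _ (begin
    sumBelow (ρ (h ∸ w)) K + weightOf μ Tg (suc w)          ≡⟨ cong (_+ weightOf μ Tg (suc w)) (sym (sumBelow-greedyTab (<⇒≤ w<h))) ⟩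
    sumBelow (boxesAtMost Tg w) K + weightOf μ Tg (suc w)   ≡⟨ sumBelow-boxesAtMost-suc Tg w ⟩
    sumBelow (boxesAtMost Tg (suc w)) K                     ≡⟨ sumBelow-greedyTab w<h ⟩
    sumBelow (ρ (h ∸ suc w)) K                              ≡⟨ sym (sumBelow-ρ-step w<h) ⟩
    sumBelow (ρ (h ∸ w)) K + nth a w                        ∎)
    where open ≡-Reasoning

  greedyTab-SSYT : IsSSYT μ a Tg
  greedyTab-SSYT = greedyTab-range , greedyTab-rows , greedyTab-columns , greedyTab-weight

  module _ {S : Tableau} (S-SSYT : IsSSYT μ a S) where
    private
      S-range   = proj₁ S-SSYT
      S-rows    = proj₁ (proj₂ S-SSYT)
      S-columns = proj₁ (proj₂ (proj₂ S-SSYT))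
      S-weight  = proj₂ (proj₂ (proj₂ S-SSYT))

    tau-full : tau μ Tg h ≡ tau μ S h
    tau-full = tau-≡ Tg S h (λ p → trans (boxesAtMost-full Tg (λ p q q<μₚ → proj₂ (greedyTab-range p q q<μₚ)) p)
                                         (sym (boxesAtMost-full S (λ p q q<μₚ → proj₂ (S-range p q q<μₚ)) p)))

    module AtLevel {v : ℕ} (v<h : v < h) (agree : tau μ Tg (suc v) ≡ tau μ S (suc v)) where
      private
        i = h ∸ suc v
        i<h : i < h
        i<h = ∸-monoʳ-< z<s v<h
        ν = boxesAtMost S v

        above≡ρ : ∀ p → boxesAtMost S (suc v) p ≡ ρ i p
        above≡ρ p = trans (sym (boxesAtMost-≡ Tg S (suc v) agree p)) (greedyTab-boxesAtMost v<h p)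

        ν≤ρ : ∀ p → ν p ≤ ρ i p
        ν≤ρ p = subst (ν p ≤_) (above≡ρ p) (boxesAtMost-mono S (n≤1+n v) p)

        ρ≤ν : ∀ p → ρ i (suc p) ≤ ν p
        ρ≤ν p = subst (_≤ ν p) (above≡ρ (suc p)) (boxesAtMost-column S S-rows S-columns (Admissible.antitone μ-admissible) v p)

        ν-total : sumBelow ν K + nth a v ≡ sumBelow (ρ i) K
        ν-total = begin
          sumBelow ν K + nth a v                       ≡⟨ cong (sumBelow ν K +_) (sym (S-weight (suc v) (s≤s z≤n) v<h)) ⟩
          sumBelow ν K + weightOf μ S (suc v)          ≡⟨ sumBelow-boxesAtMost-suc S v ⟩
          sumBelow (boxesAtMost S (suc v)) K           ≡⟨ sumBelow-cong _ _ K (λ p _ → above≡ρ p) ⟩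
          sumBelow (ρ i) K                             ∎
          where open ≡-Reasoning

      sumBelow-boxesAtMost-≤ : ∀ j → sumBelow ν j ≤ sumBelow (ρ (h ∸ v)) j
      sumBelow-boxesAtMost-≤ j = subst (λ x → sumBelow ν j ≤ sumBelow (ρ x) j) (sym (+-∸-assoc 1 v<h))
        (Step.rho-dominates-interlacing i<h ν ν≤ρ ρ≤ν
          (trans (cong (sumBelow ν K +_) (lastOr0-aSeq a v<h)) ν-total) j)

      sumBelow-boxesAtMost-total : sumBelow (ρ (h ∸ v)) K ≡ sumBelow ν K
      sumBelow-boxesAtMost-total = +-cancelʳ-≡ (nth a v) _ _ (trans (sumBelow-ρ-step v<h) (sym ν-total))

      boxesAtMost-support : ∀ p → ν p ≡ 0 → ρ (h ∸ v) p ≡ 0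
      boxesAtMost-support = dominated-support ν (ρ (h ∸ v)) (λ p → ≤-trans (ν≤ρ (suc p)) (ρ≤ν p))
        (λ p K≤p → boxesAtMost-beyond S v K≤p) (ρ-vanishes (m∸n≤m h v))
        sumBelow-boxesAtMost-≤ sumBelow-boxesAtMost-total

      tau-⊵ : stripZeros (tau μ Tg v) ⊵ stripZeros (tau μ S v)
      tau-⊵ = stripZeros-⊵ (tau μ Tg v) (tau μ S v)
        (λ p νₚ≡0 → trans (nth-T p) (boxesAtMost-support p (trans (sym (nth-tau S v p)) νₚ≡0)))
        (λ j → subst₂ _≤_ (sumBelow-cong _ _ j (λ p _ → sym (nth-tau S v p)))
                          (sumBelow-cong _ _ j (λ p _ → sym (nth-T p))) (sumBelow-boxesAtMost-≤ j))
        where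
        nth-T : ∀ p → nth (tau μ Tg v) p ≡ ρ (h ∸ v) p
        nth-T p = trans (nth-tau Tg v p) (greedyTab-boxesAtMost (<⇒≤ v<h) p)

    greedyTab-≥ : S ≤Tab[ μ , a ] Tg
    greedyTab-≥ with largestFailure (λ v → tau μ Tg v ≡ tau μ S v) (λ v → ≡-dec _≟_ (tau μ Tg v) (tau μ S v)) h
    ... | inj₁ agree = inj₁ (tau-injective S Tg S-rows greedyTab-rows S-range greedyTab-range
                               (λ u 1≤u u≤h → sym (agree u 1≤u u≤h)))
    ... | inj₂ (v , 1≤v , v≤h , agree-above , disagree) =
      inj₂ (v , 1≤v , v≤h , agree-above , AtLevel.tau-⊵ v<h (agree-above (suc v) ≤-refl v<h) , disagree-stripped)
      where
      v<h : v < h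
      v<h = ≤∧≢⇒< v≤h (λ v≡h → disagree (subst (λ x → tau μ Tg x ≡ tau μ S x) (sym v≡h) tau-full))
      disagree-stripped : ¬ stripZeros (tau μ Tg v) ≡ stripZeros (tau μ S v)
      disagree-stripped = disagree ∘ stripZeros-injective _ _
        (trans (length-applyUpTo (boxesAtMost Tg v) K) (sym (length-applyUpTo (boxesAtMost S v) K)))

theorem3p2 : (n : ℕ) (μ a : List ℕ) →
    IsPartition μ n → IsComposition a n → μ ⊵ lam a →
    IsSSYT μ a (greedyTab μ a) ×
    (∀ (S : Tableau) → IsSSYT μ a S → S ≤Tab[ μ , a ] greedyTab μ a)
theorem3p2 n μ a μ⊢n a⊨n μ⊵λa = greedyTab-SSYT , λ S S-SSYT → greedyTab-≥ S-SSYT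
  where open Greedy μ⊢n a⊨n μ⊵λa
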